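{- Let $k>9$. Every subcubic graph $G$ with $\operatorname{tww}(G)\geq k$ that has minimal order among all subcubic graphs of twin-width at least $k$ has girth at least $5$.
   Context: All graphs are finite and simple. A graph is subcubic if its maximum degree is at most $3$. The girth is the length of a shortest cycle (infinite for acyclic graphs). A trigraph is a graph whose edges are colored red or black; a graph is a trigraph with all edges black. For a partition $\mathcal{P}$ of $V(G)$, the quotient trigraph $G/\mathcal{P}$ has vertex set $\mathcal{P}$; two parts $U,W$ are joined by a black edge if every pair $u\in U,w\in W$ is a black edge, are non-adjacent if no such pair is an edge, and are joined by a red edge otherwise. A contraction sequence of an $n$-vertex trigraph $G$ is a sequence $\mathcal{P}_n,\dots,\mathcal{P}_1$ of partitions with $\mathcal{P}_n$ discrete and each $\mathcal{P}_i$ obtained from $\mathcal{P}_{i+1}$ by merging two parts; its width is the maximum red degree over all $G/\mathcal{P}_i$; $\operatorname{tww}(G)$ is the minimum width. -}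

module Defs where

open import Data.Nat using (ℕ; zero; suc; _+_; _≤_; _<_)
open import Data.Bool using (Bool; true; false; _∧_; _∨_; not; if_then_else_)
open import Data.Fin using (Fin; zero; suc; inject₁; fromℕ; _≟_)
open import Data.Product using (Σ; ∃; ∃-syntax; _×_; _,_)
open import Data.Sum using (_⊎_)
open import Relation.Nullary using (¬_)
open import Relation.Nullary.Decidable using (⌊_⌋)
open import Relation.Binary.PropositionalEquality using (_≡_; _≢_)
open import Function.Definitions using (Injective)
open import Function.Bundles using (_⇔_)

anyF : (n : ℕ) → (Fin n → Bool) → Bool
anyF zero    p = false
anyF (suc n) p = p zero ∨ anyF n (λ i → p (suc i))

countF : (n : ℕ) → (Fin n → Bool) → ℕ
countF zero    p = 0
countF (suc n) p = (if p zero then 1 else 0) + countF n (λ i → p (suc i))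

record Graph : Set where
  field
    n    : ℕ
    adj  : Fin n → Fin n → Bool
    sym  : ∀ x y → adj x y ≡ adj y x
    irr  : ∀ x → adj x x ≡ false
open Graph public

degree : (G : Graph) → Fin (n G) → ℕ
degree G x = countF (n G) (adj G x)

Subcubic : Graph → Set
Subcubic G = ∀ x → degree G x ≤ 3

-- A partition of Fin m is given by a labelling of vertices by part names
-- (at most m parts, so labels in Fin m suffice); parts = label classes.
Labelling : ℕ → Set
Labelling m = Fin m → Fin m

Discrete : {m : ℕ} → Labelling m → Set
Discrete {m} l = ∀ (x y : Fin m) → l x ≡ l y → x ≡ y

Merge : {m : ℕ} → Labelling m → Labelling m → Set
Merge {m} l l' = Σ (Fin m) λ a → Σ (Fin m) λ b → (l a ≢ l b) ×
  (∀ (x y : Fin m) → (l' x ≡ l' y) ⇔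
     ((l x ≡ l y) ⊎ ((l x ≡ l a × l y ≡ l b) ⊎ (l x ≡ l b × l y ≡ l a))))

module _ (G : Graph) where
  private
    N = n G
    _==_ : Fin N → Fin N → Bool
    i == j = ⌊ i ≟ j ⌋

  someEdge : Labelling N → Fin N → Fin N → Bool
  someEdge l U W = anyF N λ x → anyF N λ y → (l x == U) ∧ ((l y == W) ∧ adj G x y)

  someNonEdge : Labelling N → Fin N → Fin N → Bool
  someNonEdge l U W = anyF N λ x → anyF N λ y → (l x == U) ∧ ((l y == W) ∧ not (adj G x y))

  -- red edge between distinct parts U, W of the quotient trigraph G/P
  redEdge : Labelling N → Fin N → Fin N → Bool
  redEdge l U W = not (U == W) ∧ (someEdge l U W ∧ someNonEdge l U W)

  redDegree : Labelling N → Fin N → ℕ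
  redDegree l U = countF N (redEdge l U)

  -- contraction sequence P_n, ..., P_1 (seq i = partition after i merges)
  -- of width at most d
  record ContractionSeq (d : ℕ) : Set where
    field
      seq   : ℕ → Labelling N
      start : Discrete (seq 0)
      step  : ∀ i → suc i < N → Merge (seq i) (seq (suc i))
      width : ∀ i → i < N → ∀ U → redDegree (seq i) U ≤ d

  TwwAtMost : ℕ → Set
  TwwAtMost d = ContractionSeq d

  TwwAtLeast : ℕ → Set
  TwwAtLeast k = ∀ d → TwwAtMost d → k ≤ d

  -- a cycle of length suc m: injective closed walk v0 v1 ... vm v0
  record Cycle (m : ℕ) : Set where
    field
      len≥3  : 3 ≤ suc m
      vtx    : Fin (suc m) → Fin N
      inj    : Injective _≡_ _≡_ vtx
      consec : ∀ (i : Fin m) → adj G (vtx (inject₁ i)) (vtx (suc i)) ≡ true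
      close  : adj G (vtx (fromℕ m)) (vtx zero) ≡ true

  GirthAtLeast : ℕ → Set
  GirthAtLeast g = ∀ m → Cycle m → g ≤ suc m

{-# OPTIONS --safe #-}
-- If G has a triangle xyz, identify x, y and z to one vertex; if it has a 4-cycle abcd,
-- identify a with b and c with d.  Either way the quotient H is subcubic and has two
-- vertices fewer.  A contraction sequence of H of width d lifts to one of G of width
-- max(d, 9): first perform the two merges that create H (parts of at most three vertices
-- of degree ≤ 3 have red degree ≤ 9), then follow the sequence of H on preimages.  There,
-- if a part P of H has only red neighbours, the preimage of P has at most as many; otherwise
-- P is completely joined to some vertex q, so P ⊆ N(q) and every red neighbour of the
-- preimage of P contains a vertex mapped into N(N(q)), which has at most 9 elements.
-- Hence tww H ≥ k > 9, contradicting the minimality of G.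
module Submission where

open import Defs hiding (sym)
open import Data.Bool using (Bool; true; false; T; _∧_; _∨_; not; if_then_else_)
open import Data.Bool.Properties using (T-∧; T-∨; T-≡; ∨-comm; ¬-not)
open import Data.Empty using (⊥; ⊥-elim)
open import Data.Fin using (Fin; zero; suc; _≟_; punchIn; punchOut)
open import Data.Fin.Properties using (punchInᵢ≢i; punchOut-cong; punchOut-punchIn; punchOut-injective)
open import Data.List using (List; []; _∷_; _++_; map; concatMap; length)
open import Data.List.Properties using (length-++; length-map)
open import Data.List.Relation.Unary.Any using (here; there)
open import Data.List.Membership.Propositional using (_∈_; _∉_)
open import Data.List.Membership.Propositional.Properties using (∈-map⁺; ∈-++⁺ˡ; ∈-++⁺ʳ; ∈-concat⁺′)
open import Data.Nat using (ℕ; zero; suc; pred; _+_; _*_; _⊔_; _≤_; _<_; z≤n; s≤s; s≤s⁻¹)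
open import Data.Nat.Properties
  using (≤-trans; ≤-reflexive; ≤-total; +-suc; +-mono-≤; +-monoʳ-≤; *-monoˡ-≤; m≤n⇒m≤1+n;
         m≤m⊔n; m≤n⊔m; m≤n⇒m⊔n≡n; m≥n⇒m⊔n≡m; <⇒≱; pred[n]≤n; pred-mono-≤; m≤m+n)
import Data.Product as Prod
open import Data.Product using (∃; ∃₂; _×_; _,_; proj₁; proj₂)
import Data.Sum as Sum
open import Data.Sum using (_⊎_; inj₁; inj₂; [_,_]′)
open import Function using (id; _∘_; case_of_)
open import Function.Bundles using (_⇔_; mk⇔; Equivalence)
open import Function.Definitions using (Injective)
open import Function.Properties.Equivalence using () renaming (trans to ⇔-trans; sym to ⇔-sym)
open import Relation.Nullary using (¬_; yes; no; does; contradiction)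
open import Relation.Nullary.Decidable using (⌊_⌋; T?; toWitness; fromWitness; toWitnessFalse; fromWitnessFalse)
open import Relation.Binary.PropositionalEquality using (_≡_; _≢_; refl; sym; trans; cong; subst; ≢-sym)

open Equivalence using (to; from)

T-not⇒¬T : ∀ {b} → T (not b) → ¬ T b
T-not⇒¬T {false} _ ()

¬T-not⇒T : ∀ {b} → ¬ T (not b) → T b
¬T-not⇒T {true}  _  = _
¬T-not⇒T {false} ¬t = ⊥-elim (¬t _)

≤-⊔-cancelʳ : ∀ {k d e} → e < k → k ≤ d ⊔ e → k ≤ d
≤-⊔-cancelʳ {k} {d} {e} e<k k≤d⊔e with ≤-total d e
... | inj₁ d≤e = contradiction (subst (k ≤_) (m≤n⇒m⊔n≡n d≤e) k≤d⊔e) (<⇒≱ e<k)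
... | inj₂ e≤d = subst (k ≤_) (m≥n⇒m⊔n≡m e≤d) k≤d⊔e

length-concatMap-≤ : ∀ {A B : Set} (f : A → List B) (xs : List A) {c} →
  (∀ x → x ∈ xs → length (f x) ≤ c) → length (concatMap f xs) ≤ length xs * c
length-concatMap-≤ f []       f≤c = z≤n
length-concatMap-≤ f (x ∷ xs) f≤c = begin
  length (f x ++ concatMap f xs)          ≡⟨ length-++ (f x) ⟩
  length (f x) + length (concatMap f xs)  ≤⟨ +-mono-≤ (f≤c x (here refl))
                                               (length-concatMap-≤ f xs (λ y → f≤c y ∘ there)) ⟩
  _                                       ∎
  where open Data.Nat.Properties.≤-Reasoning

anyF⁺ : ∀ {n} (p : Fin n → Bool) {i} → T (p i) → T (anyF n p)
anyF⁺ p {zero}  pi = from (T-∨ {p zero}) (inj₁ pi)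
anyF⁺ p {suc i} pi = from (T-∨ {p zero}) (inj₂ (anyF⁺ (p ∘ suc) pi))

anyF⁻ : ∀ n (p : Fin n → Bool) → T (anyF n p) → ∃ λ i → T (p i)
anyF⁻ (suc n) p t with to (T-∨ {p zero}) t
... | inj₁ p0 = zero , p0
... | inj₂ ps with anyF⁻ n (p ∘ suc) ps
...   | i , pi = suc i , pi

enumerate : ∀ n → (Fin n → Bool) → List (Fin n)
enumerate zero    p = []
enumerate (suc n) p = if p zero then zero ∷ rest else rest
  where
  rest : List (Fin (suc n))
  rest = map suc (enumerate n (p ∘ suc))

length-enumerate : ∀ n p → length (enumerate n p) ≡ countF n p
length-enumerate zero    p = refl
length-enumerate (suc n) p with p zero
... | true  = cong suc (trans (length-map suc (enumerate n (p ∘ suc))) (length-enumerate n (p ∘ suc)))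
... | false = trans (length-map suc (enumerate n (p ∘ suc))) (length-enumerate n (p ∘ suc))

length-map-enumerate : ∀ {B : Set} n p (f : Fin n → B) → length (map f (enumerate n p)) ≡ countF n p
length-map-enumerate n p f = trans (length-map f (enumerate n p)) (length-enumerate n p)

∈-enumerate : ∀ n p {i} → T (p i) → i ∈ enumerate n p
∈-enumerate (suc n) p {zero}  pi with p zero
... | true = here refl
∈-enumerate (suc n) p {suc i} pi with p zero
... | true  = there (∈-map⁺ suc (∈-enumerate n (p ∘ suc) pi))
... | false = ∈-map⁺ suc (∈-enumerate n (p ∘ suc) pi)

-- `does` rather than `⌊_⌋`, so that `(p ∖ suc u) (suc i)` reduces to `((p ∘ suc) ∖ u) i`.
_∖_ : ∀ {n} → (Fin n → Bool) → Fin n → Fin n → Bool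
(p ∖ u) i = not (does (i ≟ u)) ∧ p i

countF-false : ∀ n → countF n (λ _ → false) ≡ 0
countF-false zero    = refl
countF-false (suc n) = countF-false n

countF-mono : ∀ n {p q : Fin n → Bool} → (∀ i → T (p i) → T (q i)) → countF n p ≤ countF n q
countF-mono zero    p⊆q = z≤n
countF-mono (suc n) {p} {q} p⊆q with p zero | q zero | p⊆q zero
... | true  | true  | _  = s≤s (countF-mono n (p⊆q ∘ suc))
... | false | true  | _  = m≤n⇒m≤1+n (countF-mono n (p⊆q ∘ suc))
... | false | false | _  = countF-mono n (p⊆q ∘ suc)
... | true  | false | q0 = ⊥-elim (q0 _)

countF-∖ : ∀ n (p : Fin n → Bool) {u} → T (p u) → countF n p ≡ suc (countF n (p ∖ u))
countF-∖ (suc n) p {zero}  pu with p zero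
... | true = refl
countF-∖ (suc n) p {suc u} pu = begin
  [p0] + countF n (p ∘ suc)                ≡⟨ cong ([p0] +_) (countF-∖ n (p ∘ suc) pu) ⟩
  [p0] + suc (countF n ((p ∘ suc) ∖ u))    ≡⟨ +-suc [p0] _ ⟩
  suc (countF (suc n) (p ∖ suc u))         ∎
  where
  open Relation.Binary.PropositionalEquality.≡-Reasoning
  [p0] : ℕ
  [p0] = if p zero then 1 else 0

countF-≤-length : ∀ n {p : Fin n → Bool} (L : List (Fin n)) →
  (∀ i → T (p i) → i ∈ L) → countF n p ≤ length L
countF-≤-length n {p} [] p⊆[] =
  ≤-trans (countF-mono n (λ i pi → case p⊆[] i pi of λ ())) (≤-reflexive (countF-false n))
countF-≤-length n {p} (x ∷ L) p⊆x∷L = ≤-trans countF-≤-suc (s≤s (countF-≤-length n L p∖x⊆L))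
  where
  countF-≤-suc : countF n p ≤ suc (countF n (p ∖ x))
  countF-≤-suc with T? (p x)
  ... | yes px = ≤-reflexive (countF-∖ n p px)
  ... | no ¬px = m≤n⇒m≤1+n (countF-mono n p⊆p∖x)
    where
    p⊆p∖x : ∀ i → T (p i) → T ((p ∖ x) i)
    p⊆p∖x i pi with i ≟ x
    ... | yes refl = ⊥-elim (¬px pi)
    ... | no _     = pi
  p∖x⊆L : ∀ i → T ((p ∖ x) i) → i ∈ L
  p∖x⊆L i t with i ≟ x
  ... | no i≢x with p⊆x∷L i t
  ...   | here i≡x  = ⊥-elim (i≢x i≡x)
  ...   | there i∈L = i∈L

countF-missing-two : ∀ n {p q : Fin n → Bool} {u v} → u ≢ v → T (p u) → T (p v) →
  ¬ T (q u) → ¬ T (q v) → (∀ i → T (q i) → T (p i)) → suc (suc (countF n q)) ≤ countF n p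
countF-missing-two n {p} {q} {u} {v} u≢v pu pv ¬qu ¬qv q⊆p = begin
  suc (suc (countF n q))                ≤⟨ s≤s (s≤s (countF-mono n q⊆p∖u∖v)) ⟩
  suc (suc (countF n ((p ∖ u) ∖ v)))    ≡⟨ cong suc (countF-∖ n (p ∖ u) p∖u-v) ⟨
  suc (countF n (p ∖ u))                ≡⟨ countF-∖ n p pu ⟨
  countF n p                            ∎
  where
  open Data.Nat.Properties.≤-Reasoning
  p∖u-v : T ((p ∖ u) v)
  p∖u-v with v ≟ u
  ... | yes v≡u = ⊥-elim (u≢v (sym v≡u))
  ... | no _    = pv
  q⊆p∖u∖v : ∀ i → T (q i) → T (((p ∖ u) ∖ v) i)
  q⊆p∖u∖v i qi with i ≟ v | i ≟ u
  ... | yes refl | _        = ⊥-elim (¬qv qi)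
  ... | no _     | yes refl = ⊥-elim (¬qu qi)
  ... | no _     | no _     = q⊆p i qi

module _ {n m : ℕ} (f : Fin n → Fin m) (r : Fin n → Fin n → Bool) where

  somePair : Fin m → Fin m → Bool
  somePair U W = anyF n λ x → anyF n λ y → ⌊ f x ≟ U ⌋ ∧ (⌊ f y ≟ W ⌋ ∧ r x y)

  somePair⁺ : ∀ {x y U W} → f x ≡ U → f y ≡ W → T (r x y) → T (somePair U W)
  somePair⁺ {x} {y} refl refl rxy = anyF⁺ _ {x} (anyF⁺ _ {y} (from (T-∧ {⌊ f x ≟ f x ⌋})
    (fromWitness refl , from (T-∧ {⌊ f y ≟ f y ⌋}) (fromWitness refl , rxy))))

  somePair⁻ : ∀ {U W} → T (somePair U W) → ∃₂ λ x y → f x ≡ U × f y ≡ W × T (r x y)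
  somePair⁻ {U} {W} t with anyF⁻ n _ t
  ... | x , t′ with anyF⁻ n _ t′
  ... | y , t″ with to (T-∧ {⌊ f x ≟ U ⌋}) t″
  ... | fx≡U , t‴ with to (T-∧ {⌊ f y ≟ W ⌋}) t‴
  ... | fy≡W , rxy = x , y , toWitness fx≡U , toWitness fy≡W , rxy

module _ (G : Graph) (l : Labelling (n G)) where

  blackEdge : Fin (n G) → Fin (n G) → Bool
  blackEdge U W = someEdge G l U W ∧ not (someNonEdge G l U W)

  redEdge⁺ : ∀ {U W} → U ≢ W → T (someEdge G l U W) → T (someNonEdge G l U W) → T (redEdge G l U W)
  redEdge⁺ {U} {W} U≢W edge nonEdge =
    from (T-∧ {not ⌊ U ≟ W ⌋}) (fromWitnessFalse U≢W , from (T-∧ {someEdge G l U W}) (edge , nonEdge))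

  redEdge⁻ : ∀ {U W} → T (redEdge G l U W) → U ≢ W × ∃₂ λ x y → l x ≡ U × l y ≡ W × T (adj G x y)
  redEdge⁻ {U} {W} t with to (T-∧ {not ⌊ U ≟ W ⌋}) t
  ... | U≢W , t′ = toWitnessFalse U≢W , somePair⁻ l (adj G) (proj₁ (to (T-∧ {someEdge G l U W}) t′))

adj-sym : ∀ G {x y} → T (adj G x y) → T (adj G y x)
adj-sym G {x} {y} = subst T (Graph.sym G x y)

neighbours : (G : Graph) → Fin (n G) → List (Fin (n G))
neighbours G x = enumerate (n G) (adj G x)

∈-neighbours : ∀ G {x y} → T (adj G x y) → y ∈ neighbours G x
∈-neighbours G {x} = ∈-enumerate (n G) (adj G x)

length-neighbours : ∀ G → Subcubic G → ∀ x → length (neighbours G x) ≤ 3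
length-neighbours G sc x = subst (_≤ 3) (sym (length-enumerate (n G) (adj G x))) (sc x)

around : (G : Graph) {B : Set} → (Fin (n G) → B) → List (Fin (n G)) → List B
around G f = concatMap (map f ∘ neighbours G)

∈-around : ∀ G {B} (f : Fin (n G) → B) {L x y} → x ∈ L → T (adj G x y) → f y ∈ around G f L
∈-around G f x∈L xy = ∈-concat⁺′ (∈-map⁺ f (∈-neighbours G xy)) (∈-map⁺ (map f ∘ neighbours G) x∈L)

length-around : ∀ G → Subcubic G → ∀ {B} (f : Fin (n G) → B) L → length (around G f L) ≤ length L * 3
length-around G sc f L = length-concatMap-≤ (map f ∘ neighbours G) L
  (λ x _ → subst (_≤ 3) (sym (length-map-enumerate (n G) (adj G x) f)) (sc x))

redDegree-≤-part : ∀ G → Subcubic G → (l : Labelling (n G)) → ∀ {U} (L : List (Fin (n G))) →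
  (∀ x → l x ≡ U → x ∈ L) → redDegree G l U ≤ length L * 3
redDegree-≤-part G sc l {U} L part⊆L =
  ≤-trans (countF-≤-length (n G) (around G l L) covers) (length-around G sc l L)
  where
  covers : ∀ W → T (redEdge G l U W) → W ∈ around G l L
  covers W t with redEdge⁻ G l {U} {W} t
  ... | _ , x , y , lx≡U , refl , xy = ∈-around G l (part⊆L x lx≡U) xy

module Quotient (G : Graph) {m : ℕ} (π : Fin (n G) → Fin m) where

  open import Data.List.Membership.DecPropositional (_≟_ {m}) using (_∈?_)

  crossing : Fin (n G) → Fin (n G) → Bool
  crossing x y = adj G x y ∧ not ⌊ π x ≟ π y ⌋

  joined : Fin m → Fin m → Bool
  joined = somePair π crossing

  joined⁻ : ∀ {p q} → T (joined p q) → p ≢ q × ∃₂ λ x y → π x ≡ p × π y ≡ q × T (adj G x y)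
  joined⁻ t with somePair⁻ π crossing t
  ... | x , y , refl , refl , c with to (T-∧ {adj G x y}) c
  ...   | xy , πx≢πy = toWitnessFalse πx≢πy , x , y , refl , refl , xy

  quotient : Graph
  quotient = record
    { n   = m
    ; adj = λ p q → joined p q ∨ joined q p
    ; sym = λ p q → ∨-comm (joined p q) (joined q p)
    ; irr = λ p → ¬-not λ t → [ no-loop , no-loop ]′ (to (T-∨ {joined p p}) (from T-≡ t))
    }
    where
    no-loop : ∀ {p} → ¬ T (joined p p)
    no-loop t = proj₁ (joined⁻ t) refl

  quotient-adj⁺ : ∀ {x y} → π x ≢ π y → T (adj G x y) → T (adj quotient (π x) (π y))
  quotient-adj⁺ {x} {y} πx≢πy xy =
    from (T-∨ {joined (π x) (π y)}) (inj₁ (somePair⁺ π crossing refl refl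
      (from (T-∧ {adj G x y}) (xy , fromWitnessFalse πx≢πy))))

  quotient-adj⁻ : ∀ {p q} → T (adj quotient p q) → p ≢ q × ∃₂ λ x y → π x ≡ p × π y ≡ q × T (adj G x y)
  quotient-adj⁻ {p} {q} t with to (T-∨ {joined p q}) t
  ... | inj₁ pq = joined⁻ pq
  ... | inj₂ qp with joined⁻ qp
  ...   | q≢p , x , y , πx≡q , πy≡p , xy = ≢-sym q≢p , y , x , πy≡p , πx≡q , adj-sym G xy

  exits : List (Fin m) → Fin (n G) → Fin (n G) → Bool
  exits X w u = adj G w u ∧ not ⌊ π u ∈? X ⌋

  degree-quotient-≤ : ∀ p (E : List (Fin m)) (F : List (Fin (n G))) {c} →
    (∀ w → π w ≡ p → w ∈ F) → (∀ w → w ∈ F → countF (n G) (exits (p ∷ E) w) ≤ c) →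
    degree quotient p ≤ length E + length F * c
  degree-quotient-≤ p E F {c} fibre⊆F exits≤c =
    ≤-trans (countF-≤-length m (E ++ concatMap leaving F) covers) length-bound
    where
    leaving : Fin (n G) → List (Fin m)
    leaving w = map π (enumerate (n G) (exits (p ∷ E) w))
    covers : ∀ q → T (adj quotient p q) → q ∈ E ++ concatMap leaving F
    covers q t with quotient-adj⁻ t | q ∈? E
    ... | _ | yes q∈E = ∈-++⁺ˡ q∈E
    ... | p≢q , x , y , refl , refl , xy | no q∉E =
      ∈-++⁺ʳ E (∈-concat⁺′ (∈-map⁺ π (∈-enumerate (n G) _ exit)) (∈-map⁺ leaving (fibre⊆F x refl)))
      where
      πy∉ : π y ∉ π x ∷ E
      πy∉ (here πy≡πx) = p≢q (sym πy≡πx)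
      πy∉ (there πy∈E) = q∉E πy∈E
      exit : T (exits (π x ∷ E) x y)
      exit = from (T-∧ {adj G x y}) (xy , fromWitnessFalse πy∉)
    length-bound : length (E ++ concatMap leaving F) ≤ length E + length F * c
    length-bound = begin
      length (E ++ concatMap leaving F)        ≡⟨ length-++ E ⟩
      length E + length (concatMap leaving F)  ≤⟨ +-monoʳ-≤ (length E)
                                                    (length-concatMap-≤ leaving F leaving≤c) ⟩
      length E + length F * c                  ∎
      where
      open Data.Nat.Properties.≤-Reasoning
      leaving≤c : ∀ w → w ∈ F → length (leaving w) ≤ c
      leaving≤c w w∈F =
        subst (_≤ c) (sym (length-map-enumerate (n G) (exits (p ∷ E) w) π)) (exits≤c w w∈F)

  exits⊆adj : ∀ X w u → T (exits X w u) → T (adj G w u)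
  exits⊆adj X w u t = proj₁ (to (T-∧ {adj G w u}) t)

  exits-≤-degree : ∀ X w → countF (n G) (exits X w) ≤ degree G w
  exits-≤-degree X w = countF-mono (n G) (exits⊆adj X w)

  exits-≤-1 : ∀ X {w u₁ u₂} → degree G w ≤ 3 → u₁ ≢ u₂ → T (adj G w u₁) → T (adj G w u₂) →
    π u₁ ∈ X → π u₂ ∈ X → countF (n G) (exits X w) ≤ 1
  exits-≤-1 X {w} deg≤3 u₁≢u₂ wu₁ wu₂ πu₁∈X πu₂∈X =
    s≤s⁻¹ (s≤s⁻¹ (≤-trans (countF-missing-two (n G) u₁≢u₂ wu₁ wu₂ (stays πu₁∈X) (stays πu₂∈X)
      (exits⊆adj X w)) deg≤3))
    where
    stays : ∀ {u} → π u ∈ X → ¬ T (exits X w u)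
    stays {u} πu∈X t = toWitnessFalse (proj₂ (to (T-∧ {adj G w u}) t)) πu∈X

  degree-quotient-singleton : ∀ p v → (∀ w → π w ≡ p → w ≡ v) → degree G v ≤ 3 → degree quotient p ≤ 3
  degree-quotient-singleton p v fibre≡v deg≤3 =
    degree-quotient-≤ p [] (v ∷ []) (λ w → here ∘ fibre≡v w)
      λ { w (here refl) → ≤-trans (exits-≤-degree (p ∷ []) w) deg≤3 }

_/_ : ∀ {m} (G : Graph) → (Fin (n G) → Fin m) → Graph
G / π = Quotient.quotient G π

open Quotient using (quotient-adj⁺; degree-quotient-≤; exits-≤-1; degree-quotient-singleton)

-- `Merge l l′` says, definitionally, `l′ x ≡ l′ y ⇔ Identified (l a) (l b) (l x) (l y)`.
Identified : {A : Set} → A → A → A → A → Set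
Identified a b x y = x ≡ y ⊎ ((x ≡ a × y ≡ b) ⊎ (x ≡ b × y ≡ a))

Identified-injective : ∀ {A B : Set} {f : A → B} → Injective _≡_ _≡_ f →
  ∀ {a b x y} → Identified (f a) (f b) (f x) (f y) ⇔ Identified a b x y
Identified-injective {f = f} f-inj = mk⇔
  (Sum.map f-inj (Sum.map (Prod.map f-inj f-inj) (Prod.map f-inj f-inj)))
  (Sum.map (cong f) (Sum.map (Prod.map (cong f) (cong f)) (Prod.map (cong f) (cong f))))

Identified-∈ : ∀ {A : Set} {a b x y : A} → Identified a b x y → x ∈ y ∷ a ∷ b ∷ []
Identified-∈ (inj₁ x≡y)               = here x≡y
Identified-∈ (inj₂ (inj₁ (x≡a , _))) = there (here x≡a)
Identified-∈ (inj₂ (inj₂ (x≡b , _))) = there (there (here x≡b))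

identify : ∀ {n} {a b : Fin n} → a ≢ b → Fin n → Fin (pred n)
identify {suc _} {a} a≢b x with x ≟ a
... | yes _   = punchOut a≢b
... | no x≢a = punchOut (x≢a ∘ sym)

unidentify : ∀ {n} {a b : Fin n} → a ≢ b → Fin (pred n) → Fin n
unidentify {suc _} {a} _ = punchIn a

identify-unidentify : ∀ {n} {a b : Fin n} (a≢b : a ≢ b) j → identify a≢b (unidentify a≢b j) ≡ j
identify-unidentify {suc _} {a} a≢b j with punchIn a j ≟ a
... | yes ↑j≡a = ⊥-elim (punchInᵢ≢i a j ↑j≡a)
... | no _     = trans (punchOut-cong a refl) (punchOut-punchIn a)

identify-≡ : ∀ {n} {a b : Fin n} (a≢b : a ≢ b) {x y} →
  identify a≢b x ≡ identify a≢b y ⇔ Identified a b x y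
identify-≡ {suc _} {a} {b} a≢b {x} {y} = mk⇔ to′ from′
  where
  to′ : identify a≢b x ≡ identify a≢b y → Identified a b x y
  to′ e with x ≟ a | y ≟ a
  ... | yes x≡a | yes y≡a = inj₁ (trans x≡a (sym y≡a))
  ... | yes x≡a | no y≢a  = inj₂ (inj₁ (x≡a , sym (punchOut-injective a≢b (y≢a ∘ sym) e)))
  ... | no x≢a  | yes y≡a = inj₂ (inj₂ (punchOut-injective (x≢a ∘ sym) a≢b e , y≡a))
  ... | no x≢a  | no y≢a  = inj₁ (punchOut-injective (x≢a ∘ sym) (y≢a ∘ sym) e)
  a~b : identify a≢b a ≡ identify a≢b b
  a~b with a ≟ a | b ≟ a
  ... | no a≢a | _       = ⊥-elim (a≢a refl)
  ... | yes _  | yes b≡a = ⊥-elim (a≢b (sym b≡a))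
  ... | yes _  | no _    = punchOut-cong a refl
  from′ : Identified a b x y → identify a≢b x ≡ identify a≢b y
  from′ (inj₁ refl)                = refl
  from′ (inj₂ (inj₁ (refl , refl))) = a~b
  from′ (inj₂ (inj₂ (refl , refl))) = sym a~b

module _ {n} {a b : Fin n} (a≢b : a ≢ b) where

  private
    ι : Fin n → Fin (pred n)
    ι = identify a≢b

  identified : ι a ≡ ι b
  identified = from (identify-≡ a≢b) (inj₂ (inj₁ (refl , refl)))

  identify-fibre : ∀ {w} → ι w ≡ ι a → w ≡ a ⊎ w ≡ b
  identify-fibre e with to (identify-≡ a≢b) e
  ... | inj₁ w≡a               = inj₁ w≡a
  ... | inj₂ (inj₁ (w≡a , _)) = inj₁ w≡a
  ... | inj₂ (inj₂ (w≡b , _)) = inj₂ w≡b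

  identify-≢ : ∀ {v} → v ≢ a → v ≢ b → ι v ≢ ι a
  identify-≢ v≢a v≢b = [ v≢a , v≢b ]′ ∘ identify-fibre

  identify-injective-off : ∀ {v w} → ι v ≢ ι a → ι w ≡ ι v → w ≡ v
  identify-injective-off ιv≢ιa e with to (identify-≡ a≢b) e
  ... | inj₁ w≡v                = w≡v
  ... | inj₂ (inj₁ (_ , refl)) = ⊥-elim (ιv≢ιa (sym identified))
  ... | inj₂ (inj₂ (_ , refl)) = ⊥-elim (ιv≢ιa refl)

module Pullback {n m : ℕ} (π : Fin n → Fin m) (s : Fin m → Fin n) (π∘s : ∀ j → π (s j) ≡ j) where

  pullback : Labelling m → Labelling n
  pullback l = s ∘ l ∘ π

  s-injective : Injective _≡_ _≡_ s
  s-injective {i} {j} e = trans (sym (π∘s i)) (trans (cong π e) (π∘s j))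

  pullback-≡ : ∀ l {x y} → pullback l x ≡ pullback l y ⇔ l (π x) ≡ l (π y)
  pullback-≡ l = mk⇔ s-injective (cong s)

  pullback-merge : ∀ {l l′} → Merge l l′ → Merge (pullback l) (pullback l′)
  pullback-merge {l} {l′} (a , b , la≢lb , merged) = s a , s b , distinct , equiv
    where
    distinct : pullback l (s a) ≢ pullback l (s b)
    distinct rewrite π∘s a | π∘s b = la≢lb ∘ s-injective
    equiv : ∀ x y → pullback l′ x ≡ pullback l′ y ⇔
      Identified (pullback l (s a)) (pullback l (s b)) (pullback l x) (pullback l y)
    equiv x y rewrite π∘s a | π∘s b =
      ⇔-trans (pullback-≡ l′) (⇔-trans (merged (π x) (π y)) (⇔-sym (Identified-injective s-injective)))

record MergeSeq (n : ℕ) : Set where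
  field
    seq   : ℕ → Labelling n
    start : Discrete (seq 0)
    step  : ∀ i → suc i < n → Merge (seq i) (seq (suc i))

mergeSeq : ∀ {G d} → ContractionSeq G d → MergeSeq (n G)
mergeSeq C = record { seq = seq ; start = start ; step = step }
  where open ContractionSeq C

extend : ∀ {n} {a b : Fin n} → a ≢ b → MergeSeq (pred n) → MergeSeq n
extend {n} {a} {b} a≢b σ = record { seq = seq′ ; start = λ _ _ → id ; step = step′ }
  where
  open MergeSeq σ
  open Pullback (identify a≢b) (unidentify a≢b) (identify-unidentify a≢b)
  seq′ : ℕ → Labelling n
  seq′ zero    = id
  seq′ (suc i) = pullback (seq i)
  step′ : ∀ i → suc i < n → Merge (seq′ i) (seq′ (suc i))
  step′ zero    _  = a , b , a≢b , λ x y →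
    ⇔-trans (pullback-≡ (seq 0)) (⇔-trans (mk⇔ (start _ _) (cong (seq 0))) (identify-≡ a≢b))
  step′ (suc i) lt = pullback-merge (step i (pred-mono-≤ lt))

module _ (G : Graph) {m} (π : Fin (n G) → Fin m) (s : Fin m → Fin (n G))
         (π∘s : ∀ j → π (s j) ≡ j) where

  open Pullback π s π∘s

  private
    H : Graph
    H = G / π

  redDegree-pullback-≤-quotient : ∀ l U →
    (∀ W → T (someEdge H l (π U) W) → T (someNonEdge H l (π U) W)) →
    redDegree G (pullback l) U ≤ redDegree H l (π U)
  redDegree-pullback-≤-quotient l U allRed =
    ≤-trans (countF-≤-length (n G) (map s (enumerate m (redEdge H l (π U)))) covers)
      (≤-reflexive (length-map-enumerate m (redEdge H l (π U)) s))
    where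
    covers : ∀ W → T (redEdge G (pullback l) U W) → W ∈ map s (enumerate m (redEdge H l (π U)))
    covers W t with redEdge⁻ G (pullback l) {U} {W} t
    ... | U≢W , x , y , refl , refl , xy rewrite π∘s (l (π x)) =
      ∈-map⁺ s (∈-enumerate m _ (redEdge⁺ H l u≢w edge (allRed _ edge)))
      where
      u≢w : l (π x) ≢ l (π y)
      u≢w = U≢W ∘ cong s
      edge : T (someEdge H l (l (π x)) (l (π y)))
      edge = somePair⁺ l (adj H) refl refl (quotient-adj⁺ G π (u≢w ∘ cong l) xy)

  redDegree-pullback-≤-9 : Subcubic H → ∀ l U q → (∀ p → l p ≡ π U → T (adj H p q)) →
    redDegree G (pullback l) U ≤ 9
  redDegree-pullback-≤-9 scH l U q dominated =
    ≤-trans (countF-≤-length (n G) (around H (s ∘ l) (neighbours H q)) covers)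
      (≤-trans (length-around H scH (s ∘ l) (neighbours H q)) (*-monoˡ-≤ 3 (length-neighbours H scH q)))
    where
    covers : ∀ W → T (redEdge G (pullback l) U W) → W ∈ around H (s ∘ l) (neighbours H q)
    covers W t with redEdge⁻ G (pullback l) {U} {W} t
    ... | U≢W , x , y , refl , refl , xy =
      ∈-around H (s ∘ l) (∈-neighbours H (adj-sym H (dominated (π x) (sym (π∘s _)))))
        (quotient-adj⁺ G π (U≢W ∘ cong (s ∘ l)) xy)

  redDegree-pullback : Subcubic H → ∀ {l d} → (∀ u → redDegree H l u ≤ d) →
    ∀ U → redDegree G (pullback l) U ≤ d ⊔ 9
  redDegree-pullback scH {l} {d} red≤d U with T? (anyF m (blackEdge H l (π U)))
  ... | no ¬black =
    ≤-trans (redDegree-pullback-≤-quotient l U allRed) (≤-trans (red≤d (π U)) (m≤m⊔n d 9))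
    where
    allRed : ∀ W → T (someEdge H l (π U) W) → T (someNonEdge H l (π U) W)
    allRed W edge = ¬T-not⇒T λ noNonEdge →
      ¬black (anyF⁺ (blackEdge H l (π U)) (from (T-∧ {someEdge H l (π U) W}) (edge , noNonEdge)))
  ... | yes t with anyF⁻ m (blackEdge H l (π U)) t
  ...   | W , blackW with to (T-∧ {someEdge H l (π U) W}) blackW
  ...     | edge , noNonEdge with somePair⁻ l (adj H) edge
  ...       | _ , q , _ , lq≡W , _ = ≤-trans (redDegree-pullback-≤-9 scH l U q dominated) (m≤n⊔m d 9)
    where
    dominated : ∀ p → l p ≡ π U → T (adj H p q)
    dominated p lp≡πU = ¬T-not⇒T λ pq-non → T-not⇒¬T noNonEdge
      (somePair⁺ l (λ x y → not (adj H x y)) lp≡πU lq≡W pq-non)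

record Reduction (G : Graph) : Set where
  field
    graph    : Graph
    smaller  : n graph < n G
    subcubic : Subcubic graph
    lift     : ∀ {d} → TwwAtMost graph d → TwwAtMost G (d ⊔ 9)

reduction-contradicts-minimality : ∀ {k G} → 9 < k → TwwAtLeast G k →
  ((H : Graph) → Subcubic H → TwwAtLeast H k → n G ≤ n H) → Reduction G → ⊥
reduction-contradicts-minimality {k} 9<k tww≥k minimal R =
  <⇒≱ smaller (minimal graph subcubic tww-graph≥k)
  where
  open Reduction R
  tww-graph≥k : TwwAtLeast graph k
  tww-graph≥k d C = ≤-⊔-cancelʳ 9<k (tww≥k (d ⊔ 9) (lift C))

pred-pred-< : ∀ {n} → Fin n → pred (pred n) < n
pred-pred-< {suc _} _ = s≤s pred[n]≤n

module DoubleIdentification (G : Graph) {a₁ b₁ : Fin (n G)} (a₁≢b₁ : a₁ ≢ b₁)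
                            {a₂ b₂ : Fin (pred (n G))} (a₂≢b₂ : a₂ ≢ b₂) where

  ι₁ : Fin (n G) → Fin (pred (n G))
  ι₁ = identify a₁≢b₁

  ι₂ : Fin (pred (n G)) → Fin (pred (pred (n G)))
  ι₂ = identify a₂≢b₂

  π : Fin (n G) → Fin (pred (pred (n G)))
  π = ι₂ ∘ ι₁

  s : Fin (pred (pred (n G))) → Fin (n G)
  s = unidentify a₁≢b₁ ∘ unidentify a₂≢b₂

  π∘s : ∀ j → π (s j) ≡ j
  π∘s j = trans (cong ι₂ (identify-unidentify a₁≢b₁ _)) (identify-unidentify a₂≢b₂ j)

  fibre-unmerged : ∀ {p w} → p ≢ π a₁ → p ≢ ι₂ a₂ → π w ≡ p → w ≡ s p
  fibre-unmerged {p} {w} p≢πa₁ p≢ι₂a₂ πw≡p = identify-injective-off a₁≢b₁ ι₁sp≢ι₁a₁ ι₁w≡ι₁sp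
    where
    s₂p : Fin (pred (n G))
    s₂p = unidentify a₂≢b₂ p
    ι₂s₂p≡p : ι₂ s₂p ≡ p
    ι₂s₂p≡p = identify-unidentify a₂≢b₂ p
    ι₁w≡ι₁sp : ι₁ w ≡ ι₁ (s p)
    ι₁w≡ι₁sp = trans
      (identify-injective-off a₂≢b₂ (p≢ι₂a₂ ∘ trans (sym ι₂s₂p≡p)) (trans πw≡p (sym ι₂s₂p≡p)))
      (sym (identify-unidentify a₁≢b₁ s₂p))
    ι₁sp≢ι₁a₁ : ι₁ (s p) ≢ ι₁ a₁
    ι₁sp≢ι₁a₁ e = p≢πa₁ (trans (sym (π∘s p)) (cong ι₂ e))

  degree-unmerged : Subcubic G → ∀ {p} → p ≢ π a₁ → p ≢ ι₂ a₂ → degree (G / π) p ≤ 3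
  degree-unmerged scG {p} p≢πa₁ p≢ι₂a₂ =
    degree-quotient-singleton G π p (s p) (λ _ → fibre-unmerged p≢πa₁ p≢ι₂a₂) (scG (s p))

  lift : Subcubic G → Subcubic (G / π) → ∀ {d} → TwwAtMost (G / π) d → TwwAtMost G (d ⊔ 9)
  lift scG scH {d} C = record { seq = seq ; start = start ; step = step ; width = width }
    where
    -- seq 0 is discrete, seq 1 merges a₁ with b₁, and seq (2 + i) is the preimage of the
    -- i-th partition of G / π.
    open MergeSeq (extend a₁≢b₁ (extend a₂≢b₂ (mergeSeq C)))
    part₁ : ∀ {U} x → seq 1 x ≡ U → x ∈ U ∷ a₁ ∷ b₁ ∷ []
    part₁ {U} x e = Identified-∈ (to (identify-≡ a₁≢b₁)
      (trans (sym (identify-unidentify a₁≢b₁ (ι₁ x))) (cong ι₁ e)))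
    width : ∀ i → i < n G → ∀ U → redDegree G (seq i) U ≤ d ⊔ 9
    width zero _ U =
      ≤-trans (redDegree-≤-part G scG id (U ∷ []) (λ _ → here)) (≤-trans (m≤m+n 3 6) (m≤n⊔m d 9))
    width (suc zero) _ U =
      ≤-trans (redDegree-≤-part G scG (seq 1) (U ∷ a₁ ∷ b₁ ∷ []) part₁) (m≤n⊔m d 9)
    width (suc (suc i)) lt U =
      redDegree-pullback G π s π∘s scH {ContractionSeq.seq C i}
        (ContractionSeq.width C i (pred-mono-≤ (pred-mono-≤ lt))) U

  reduction : Subcubic G → Subcubic (G / π) → Reduction G
  reduction scG scH = record
    { graph = G / π ; smaller = pred-pred-< a₁ ; subcubic = scH ; lift = lift scG scH }

triangle-reduction : ∀ {G} → Subcubic G → Cycle G 2 → Reduction G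
triangle-reduction {G} sc C = reduction sc subcubic
  where
  open Cycle C
  distinct : ∀ i j → i ≢ j → vtx i ≢ vtx j
  distinct i j i≢j = i≢j ∘ inj
  x y z : Fin (n G)
  x = vtx zero
  y = vtx (suc zero)
  z = vtx (suc (suc zero))
  x≢y : x ≢ y
  x≢y = distinct _ _ λ ()
  x≢z : x ≢ z
  x≢z = distinct _ _ λ ()
  y≢z : y ≢ z
  y≢z = distinct _ _ λ ()
  xy : T (adj G x y)
  xy = from T-≡ (consec zero)
  yz : T (adj G y z)
  yz = from T-≡ (consec (suc zero))
  zx : T (adj G z x)
  zx = from T-≡ close
  ι₁z≢ι₁x : identify x≢y z ≢ identify x≢y x
  ι₁z≢ι₁x = identify-≢ x≢y (≢-sym x≢z) (≢-sym y≢z)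
  open DoubleIdentification G x≢y (≢-sym ι₁z≢ι₁x)
  πy≡πx : π y ≡ π x
  πy≡πx = cong ι₂ (sym (identified x≢y))
  πz≡πx : π z ≡ π x
  πz≡πx = sym (identified (≢-sym ι₁z≢ι₁x))
  fibre : ∀ w → π w ≡ π x → w ∈ x ∷ y ∷ z ∷ []
  fibre w πw≡πx with identify-fibre (≢-sym ι₁z≢ι₁x) πw≡πx
  ... | inj₁ ι₁w≡ι₁x = [ here , there ∘ here ]′ (identify-fibre x≢y ι₁w≡ι₁x)
  ... | inj₂ ι₁w≡ι₁z = there (there (here (identify-injective-off x≢y ι₁z≢ι₁x ι₁w≡ι₁z)))
  exits≤1 : ∀ w → w ∈ x ∷ y ∷ z ∷ [] → countF (n G) (Quotient.exits G π (π x ∷ []) w) ≤ 1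
  exits≤1 _ (here refl)                 =
    exits-≤-1 G π _ (sc x) y≢z xy (adj-sym G zx) (here πy≡πx) (here πz≡πx)
  exits≤1 _ (there (here refl))         =
    exits-≤-1 G π _ (sc y) x≢z (adj-sym G xy) yz (here refl) (here πz≡πx)
  exits≤1 _ (there (there (here refl))) =
    exits-≤-1 G π _ (sc z) x≢y zx (adj-sym G yz) (here refl) (here πy≡πx)
  subcubic : Subcubic (G / π)
  subcubic p with p ≟ π x
  ... | yes refl = degree-quotient-≤ G π (π x) [] (x ∷ y ∷ z ∷ []) fibre exits≤1
  ... | no p≢πx  = degree-unmerged sc p≢πx p≢πx

square-reduction : ∀ {G} → Subcubic G → Cycle G 3 → Reduction G
square-reduction {G} sc C = reduction sc subcubic
  where
  open Cycle C
  distinct : ∀ i j → i ≢ j → vtx i ≢ vtx j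
  distinct i j i≢j = i≢j ∘ inj
  a b c d : Fin (n G)
  a = vtx zero
  b = vtx (suc zero)
  c = vtx (suc (suc zero))
  d = vtx (suc (suc (suc zero)))
  a≢b : a ≢ b
  a≢b = distinct _ _ λ ()
  a≢c : a ≢ c
  a≢c = distinct _ _ λ ()
  a≢d : a ≢ d
  a≢d = distinct _ _ λ ()
  b≢c : b ≢ c
  b≢c = distinct _ _ λ ()
  b≢d : b ≢ d
  b≢d = distinct _ _ λ ()
  c≢d : c ≢ d
  c≢d = distinct _ _ λ ()
  ab : T (adj G a b)
  ab = from T-≡ (consec zero)
  bc : T (adj G b c)
  bc = from T-≡ (consec (suc zero))
  cd : T (adj G c d)
  cd = from T-≡ (consec (suc (suc zero)))
  da : T (adj G d a)
  da = from T-≡ close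
  ι₁c≢ι₁a : identify a≢b c ≢ identify a≢b a
  ι₁c≢ι₁a = identify-≢ a≢b (≢-sym a≢c) (≢-sym b≢c)
  ι₁d≢ι₁a : identify a≢b d ≢ identify a≢b a
  ι₁d≢ι₁a = identify-≢ a≢b (≢-sym a≢d) (≢-sym b≢d)
  ι₁c≢ι₁d : identify a≢b c ≢ identify a≢b d
  ι₁c≢ι₁d = c≢d ∘ identify-injective-off a≢b ι₁d≢ι₁a
  open DoubleIdentification G a≢b ι₁c≢ι₁d
  πa≢πc : π a ≢ π c
  πa≢πc = identify-≢ ι₁c≢ι₁d (≢-sym ι₁c≢ι₁a) (≢-sym ι₁d≢ι₁a)
  πb≡πa : π b ≡ π a
  πb≡πa = cong ι₂ (sym (identified a≢b))
  πd≡πc : π d ≡ π c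
  πd≡πc = sym (identified ι₁c≢ι₁d)
  fibre-a : ∀ w → π w ≡ π a → w ∈ a ∷ b ∷ []
  fibre-a w πw≡πa =
    [ here , there ∘ here ]′ (identify-fibre a≢b (identify-injective-off ι₁c≢ι₁d πa≢πc πw≡πa))
  fibre-c : ∀ w → π w ≡ π c → w ∈ c ∷ d ∷ []
  fibre-c w πw≡πc =
    [ here ∘ identify-injective-off a≢b ι₁c≢ι₁a , there ∘ here ∘ identify-injective-off a≢b ι₁d≢ι₁a ]′
      (identify-fibre ι₁c≢ι₁d πw≡πc)
  exits-a≤1 : ∀ w → w ∈ a ∷ b ∷ [] → countF (n G) (Quotient.exits G π (π a ∷ π c ∷ []) w) ≤ 1
  exits-a≤1 _ (here refl)         =
    exits-≤-1 G π _ (sc a) b≢d ab (adj-sym G da) (here πb≡πa) (there (here πd≡πc))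
  exits-a≤1 _ (there (here refl)) =
    exits-≤-1 G π _ (sc b) a≢c (adj-sym G ab) bc (here refl) (there (here refl))
  exits-c≤1 : ∀ w → w ∈ c ∷ d ∷ [] → countF (n G) (Quotient.exits G π (π c ∷ π a ∷ []) w) ≤ 1
  exits-c≤1 _ (here refl)         =
    exits-≤-1 G π _ (sc c) (≢-sym b≢d) cd (adj-sym G bc) (here πd≡πc) (there (here πb≡πa))
  exits-c≤1 _ (there (here refl)) =
    exits-≤-1 G π _ (sc d) (≢-sym a≢c) (adj-sym G cd) da (here refl) (there (here refl))
  subcubic : Subcubic (G / π)
  subcubic p with p ≟ π a | p ≟ π c
  ... | yes refl | _        = degree-quotient-≤ G π (π a) (π c ∷ []) (a ∷ b ∷ []) fibre-a exits-a≤1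
  ... | no _     | yes refl = degree-quotient-≤ G π (π c) (π a ∷ []) (c ∷ d ∷ []) fibre-c exits-c≤1
  ... | no p≢πa  | no p≢πc  = degree-unmerged sc p≢πa p≢πc

lemma3p3 : (k : ℕ) → 9 < k → (G : Graph) → Subcubic G → TwwAtLeast G k →
    ((H : Graph) → Subcubic H → TwwAtLeast H k → n G ≤ n H) →
    GirthAtLeast G 5
lemma3p3 k 9<k G sc tww≥k minimal = girth≥5
  where
  irreducible : Reduction G → ⊥
  irreducible = reduction-contradicts-minimality 9<k tww≥k minimal
  girth≥5 : GirthAtLeast G 5
  girth≥5 0 C with Cycle.len≥3 C
  ... | s≤s ()
  girth≥5 1 C with Cycle.len≥3 C
  ... | s≤s (s≤s ())
  girth≥5 2 C = ⊥-elim (irreducible (triangle-reduction sc C))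
  girth≥5 3 C = ⊥-elim (irreducible (square-reduction sc C))
  girth≥5 (suc (suc (suc (suc m)))) _ = m≤m+n 5 m
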